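{- For every $k\in\mathbb{N}$, the graph $K_{2k+2}^{(2)}$ does not admit $(k,1)$-balanced separators.
   Context: $H^{(2)}$ denotes the $2$-subdivision of $H$: the graph obtained from $H$ by replacing each edge with a path of length $3$ (two new internal vertices per edge). For a graph $G$, $\hat S\subseteq V(G)$ and $r\in\mathbb{N}$, $N^r_G[\hat S]$ is the set of vertices at distance at most $r$ from $\hat S$ in $G$. A set $S\subseteq V(G)$ is $(k,r)$-centred if $S\subseteq N_G^r[\hat S]$ for some $\hat S\subseteq V(G)$ with $|\hat S|\le k$. For $\mu\colon V(G)\to\mathbb{R}_{\ge0}$, a set $S$ is a balanced separator for $\mu$ if every connected component $C$ of $G-S$ satisfies $\sum_{v\in V(C)}\mu(v)\le\frac12\sum_{v\in V(G)}\mu(v)$. $G$ admits $(k,r)$-balanced separators if for every $\mu\colon V(G)\to\mathbb{R}_{\ge0}$ some $(k,r)$-centred set is a balanced separator for $\mu$. -}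

module Defs where

open import Data.Nat using (ℕ; zero; suc)
open import Data.Fin using (Fin; zero; suc; punchIn)
open import Data.Rational using (ℚ; 0ℚ; ½; _+_; _*_; _≤_)
open import Data.Bool using (Bool; true; false; if_then_else_)
open import Data.Sum using (_⊎_; inj₁; inj₂)
open import Data.Product using (_×_; Σ; ∃; ∃-syntax)
open import Data.Empty using (⊥)
open import Data.List using (List; length)
open import Data.List.Membership.Propositional using (_∈_)
open import Relation.Binary.PropositionalEquality using (_≡_)
open import Relation.Nullary using (¬_)

∑ : (n : ℕ) → (Fin n → ℚ) → ℚ
∑ zero    f = 0ℚ
∑ (suc n) f = f zero + ∑ n (λ i → f (suc i))

-- A finite (simple, undirected) graph: vertex type, adjacency relation,
-- and summation of a weight function over all vertices (each vertex once).
record Graph : Set₁ where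
  field
    V    : Set
    Adj  : V → V → Set
    sumV : (V → ℚ) → ℚ
open Graph public

module _ (G : Graph) where
  private
    W = V G
    E = Adj G

  data Dist≤ : ℕ → W → W → Set where
    here : ∀ {r u} → Dist≤ r u u
    step : ∀ {r u w v} → E u w → Dist≤ r w v → Dist≤ (suc r) u v

  Centred : ℕ → ℕ → (W → Bool) → Set
  Centred k r S = ∃[ Ŝ ] (length Ŝ Data.Nat.≤ k) ×
                  (∀ v → S v ≡ true → ∃[ s ] (s ∈ Ŝ × Dist≤ r s v))

  data Conn (P : W → Set) : W → W → Set where
    start : ∀ {u} → P u → Conn P u u
    extend : ∀ {u v w} → Conn P u v → E v w → P w → Conn P u w

  IsComponent : (W → Bool) → (W → Bool) → Set
  IsComponent S C =
    (∃[ v ] C v ≡ true) ×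
    (∀ v → C v ≡ true → S v ≡ false) ×
    (∀ u v → C u ≡ true → C v ≡ true → Conn (λ x → C x ≡ true) u v) ×
    (∀ u v → C u ≡ true → E u v → S v ≡ false → C v ≡ true)

  weight : (W → ℚ) → (W → Bool) → ℚ
  weight μ C = sumV G (λ v → if C v then μ v else 0ℚ)

  BalancedSep : (W → ℚ) → (W → Bool) → Set
  BalancedSep μ S = ∀ C → IsComponent S C → weight μ C ≤ ½ * sumV G μ

  AdmitsBalancedSeps : ℕ → ℕ → Set
  AdmitsBalancedSeps k r =
    ∀ (μ : W → ℚ) → (∀ v → 0ℚ ≤ μ v) →
    ∃[ S ] (Centred k r S × BalancedSep μ S)

-- The 2-subdivision of K_{m+1}.  Vertices: original vertices  orig i,
-- and for each ordered pair (i , j) with i ≠ j a subdivision vertex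
-- sub i d, where j = punchIn i d (punchIn i : Fin m → Fin (suc m) is a
-- bijection onto Fin (suc m) ∖ {i}).  The edge {i,j} becomes the path
-- orig i — sub i d — sub j e — orig j  (j = punchIn i d, i = punchIn j e).
data KV (m : ℕ) : Set where
  orig : Fin (suc m) → KV m
  sub  : Fin (suc m) → Fin m → KV m

data KAdj (m : ℕ) : KV m → KV m → Set where
  o-s : ∀ i d → KAdj m (orig i) (sub i d)
  s-o : ∀ i d → KAdj m (sub i d) (orig i)
  s-s : ∀ i d j e → punchIn i d ≡ j → punchIn j e ≡ i → KAdj m (sub i d) (sub j e)

KSum : (m : ℕ) → (KV m → ℚ) → ℚ
KSum m f = ∑ (suc m) (λ i → f (orig i)) + ∑ (suc m) (λ i → ∑ m (λ d → f (sub i d)))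

K⁽²⁾ : ℕ → Graph
K⁽²⁾ m = record { V = KV m ; Adj = KAdj m ; sumV = KSum m }

-- Put unit weight on the 2k + 2 branch vertices of K⁽²⁾ and none on the
-- subdivision vertices.  A (k,1)-centred set S lies in k balls of radius 1,
-- and each ball lies inside the star of one branch vertex (the vertex and the
-- subdivided edges at it): call that branch vertex its owner.  If i and j are
-- not owned, then no vertex of the subdivided edge ij lies in S, so the at
-- least k + 2 unowned branch vertices all lie in one component of G - S,
-- which then weighs more than half.
module Submission where

open import Defs
open import Data.Nat using (ℕ; zero; suc; _+_; _*_; _∸_; _≤_; _<_; z≤n; s≤s)
open import Data.Nat.Properties
  using (≤-trans; ≤-reflexive; n≤1+n; m≤m+n; +-suc; +-mono-≤; +-monoʳ-≤; <-irrefl;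
         m+n∸m≡n; ∸-monoʳ-≤; module ≤-Reasoning)
open import Data.Nat.GeneralisedArithmetic using (iterate)
open import Data.Nat.Tactic.RingSolver using (solve-∀)
open import Data.Fin using (Fin; zero; suc; punchIn; punchOut)
open import Data.Fin.Properties using (_≟_; punchIn-punchOut)
open import Data.Fin.Subset
  using (Subset; inside; outside; _∪_; ⋃; ⁅_⁆; ∁; ∣_∣; Nonempty; _∉_; _⊆_)
  renaming (_∈_ to _∈ₛ_)
open import Data.Fin.Subset.Properties
  using (∣⊥∣≡0; ∣⁅x⁆∣≡1; ∣p∣≤∣x∷p∣; ∣∁p∣≡n∸∣p∣; p⊆q⇒∣p∣≤∣q∣; x∈⁅x⁆; x∈p∪q⁺; x∈∁p⇒x∉p;
         nonempty?; Empty-unique)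
open import Data.Bool using (Bool; true; false; T; not; _∧_; _∨_; if_then_else_)
open import Data.Bool.Properties using (T?; T-≡; T-not-≡; T-∧; T-∨; ¬-not; if-eta)
open import Data.Bool.ListAction using (any)
open import Data.Rational using (ℚ; 0ℚ; 1ℚ; ½)
  renaming (_+_ to _+ᵣ_; _*_ to _*ᵣ_; _≤_ to _≤ᵣ_; _<_ to _<ᵣ_)
import Data.Rational.Properties as ℚ
open import Data.Product using (_×_; _,_; ∃-syntax; proj₁; proj₂)
open import Data.Sum using (_⊎_; inj₁; inj₂)
open import Data.Empty using (⊥-elim)
open import Data.List using (List; []; _∷_; length; map; _++_; cartesianProductWith; allFin)
open import Data.List.Properties using (length-map)
open import Data.List.Membership.Propositional using (_∈_; find; lose)
open import Data.List.Membership.Propositional.Properties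
  using (∈-map⁺; ∈-++⁺ˡ; ∈-++⁺ʳ; ∈-allFin; ∈-cartesianProductWith⁺)
open import Data.List.Relation.Unary.Any using (here; there; any?)
open import Data.List.Relation.Unary.Any.Properties using (any⁺; any⁻)
open import Data.Vec using (_∷_; []; tabulate)
open import Data.Vec.Properties using (lookup∘tabulate; lookup⇒[]=)
open import Function using (_∘_; Equivalence; case_of_)
open import Relation.Binary.Definitions using (Decidable; DecidableEquality; Symmetric)
open import Relation.Binary.PropositionalEquality
  using (_≡_; refl; sym; trans; cong; cong₂; subst; subst₂; module ≡-Reasoning)
open import Relation.Nullary using (¬_; yes; no; contradiction)
open import Relation.Nullary.Decidable
  using (isYes; map′; _×-dec_; ¬?; decidable-stable; toWitness; fromWitness)

open Equivalence using (to; from)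

module _ {G : Graph} {P : V G → Set} where

  Conn-last : ∀ {u v} → Conn G P u v → P v
  Conn-last (start p) = p
  Conn-last (extend _ _ p) = p

  Conn-++ : ∀ {u v w} → Conn G P u v → Conn G P v w → Conn G P u w
  Conn-++ c (start _) = c
  Conn-++ c (extend c′ e p) = extend (Conn-++ c c′) e p

  Conn-reverse : Symmetric (Adj G) → ∀ {u v} → Conn G P u v → Conn G P v u
  Conn-reverse adj-sym (start p) = start p
  Conn-reverse adj-sym (extend c e p) =
    Conn-++ (extend (start p) (adj-sym e) (Conn-last c)) (Conn-reverse adj-sym c)

Conn-map : ∀ {G : Graph} {P Q : V G → Set} → (∀ {x} → P x → Q x) →
           ∀ {u v} → Conn G P u v → Conn G Q u v
Conn-map f (start p) = start (f p)
Conn-map f (extend c e p) = extend (Conn-map f c) e (f p)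

IsComponent-closed : ∀ {G : Graph} {S C : V G → Bool} → IsComponent G S C →
                     ∀ {u v} → C u ≡ true → Conn G (λ x → S x ≡ false) u v → C v ≡ true
IsComponent-closed comp Cu (start _) = Cu
IsComponent-closed comp Cu (extend c e Sw) =
  proj₂ (proj₂ (proj₂ comp)) _ _ (IsComponent-closed comp Cu c) e Sw

_⊆ᵇ_ : ∀ {A : Set} → (A → Bool) → (A → Bool) → Set
X ⊆ᵇ Y = ∀ {x} → T (X x) → T (Y x)

iterate-preserves : ∀ {A : Set} (P : A → Set) {f : A → A} → (∀ {x} → P x → P (f x)) →
                    ∀ {x} n → P x → P (iterate f x n)
iterate-preserves P pf zero px = px
iterate-preserves P pf (suc n) px = iterate-preserves P pf n (pf px)

module _ {A : Set} where

  count : (A → Bool) → List A → ℕ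
  count X [] = 0
  count X (y ∷ ys) = if X y then suc (count X ys) else count X ys

  count≤length : ∀ X ys → count X ys ≤ length ys
  count≤length X [] = z≤n
  count≤length X (y ∷ ys) with X y
  ... | true = s≤s (count≤length X ys)
  ... | false = ≤-trans (count≤length X ys) (n≤1+n _)

  count-mono : ∀ {X Y} → X ⊆ᵇ Y → ∀ ys → count X ys ≤ count Y ys
  count-mono X⊆Y [] = z≤n
  count-mono {X} {Y} X⊆Y (y ∷ ys) with X y | Y y | X⊆Y {y}
  ... | true  | true  | _ = s≤s (count-mono X⊆Y ys)
  ... | true  | false | h = contradiction (h _) λ ()
  ... | false | true  | _ = ≤-trans (count-mono X⊆Y ys) (n≤1+n _)
  ... | false | false | _ = count-mono X⊆Y ys

  count-mono-< : ∀ {X Y x ys} → X ⊆ᵇ Y → x ∈ ys → ¬ T (X x) → T (Y x) →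
                 count X ys < count Y ys
  count-mono-< {X} {Y} {ys = y ∷ ys} X⊆Y (here refl) ¬Xy Yy with X y | Y y
  ... | false | true = s≤s (count-mono X⊆Y ys)
  ... | true  | _    = contradiction _ ¬Xy
  count-mono-< {X} {Y} {ys = y ∷ ys} X⊆Y (there x∈ys) ¬Xx Yx
    with X y | Y y | X⊆Y {y} | count-mono-< X⊆Y x∈ys ¬Xx Yx
  ... | true  | true  | _ | lt = s≤s lt
  ... | true  | false | h | _  = contradiction (h _) λ ()
  ... | false | true  | _ | lt = ≤-trans lt (n≤1+n _)
  ... | false | false | _ | lt = lt

  Closed : ((A → Bool) → A → Bool) → (A → Bool) → Set
  Closed F X = F X ⊆ᵇ X

module _ {A : Set} (elements : List A) (∈-elements : ∀ x → x ∈ elements) where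

  closed-or-escapes : ∀ F X → Closed F X ⊎ ∃[ x ] (T (F X x) × ¬ T (X x))
  closed-or-escapes F X with any? (λ x → T? (F X x) ×-dec ¬? (T? (X x))) elements
  ... | yes escape = let x , _ , p = find escape in inj₂ (x , p)
  ... | no none = inj₁ λ {x} FXx →
    decidable-stable (T? (X x)) λ ¬Xx → none (lose (∈-elements x) (FXx , ¬Xx))

  -- Each step that is not yet closed adds an element, which can happen at
  -- most  length elements  times.
  iterate-closes : ∀ F → (∀ X → X ⊆ᵇ F X) → ∀ X₀ → ∃[ N ] Closed F (iterate F X₀ N)
  iterate-closes F inflationary X₀ = go (length elements) X₀ (m≤m+n _ _)
    where
    open ≤-Reasoning

    grows : ∀ X x → T (F X x) → ¬ T (X x) → count X elements < count (F X) elements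
    grows X x FXx ¬Xx = count-mono-< (inflationary X) (∈-elements x) ¬Xx FXx

    go : ∀ fuel X → length elements ≤ fuel + count X elements →
         ∃[ N ] Closed F (iterate F X N)
    go fuel X bound with closed-or-escapes F X
    go _ X _ | inj₁ closed = 0 , closed
    go zero X bound | inj₂ (x , FXx , ¬Xx) = ⊥-elim (<-irrefl refl
      (≤-trans (grows X x FXx ¬Xx) (≤-trans (count≤length (F X) elements) bound)))
    go (suc fuel) X bound | inj₂ (x , FXx , ¬Xx) =
      let N , closed = go fuel (F X) (≤-trans bound (begin
            suc fuel + count X elements   ≡⟨ +-suc fuel _ ⟨
            fuel + suc (count X elements) ≤⟨ +-monoʳ-≤ fuel (grows X x FXx ¬Xx) ⟩
            fuel + count (F X) elements   ∎))
      in suc N , closed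

module _ (G : Graph) (elements : List (V G)) (∈-elements : ∀ v → v ∈ elements)
         (_≟ᴳ_ : DecidableEquality (V G)) (adj? : Decidable (Adj G))
         (adj-sym : Symmetric (Adj G)) (S : V G → Bool) where

  -- The component of v₀ in G - S is the first closed iterate of grow from {v₀}.
  grow : (V G → Bool) → V G → Bool
  grow X v = X v ∨ (not (S v) ∧ any (λ u → X u ∧ isYes (adj? u v)) elements)

  grow-inflationary : ∀ X → X ⊆ᵇ grow X
  grow-inflationary X Xv = from T-∨ (inj₁ Xv)

  grow-adjacent : ∀ {X u v} → T (X u) → Adj G u v → S v ≡ false → T (grow X v)
  grow-adjacent {u = u} Xu e Sv = from T-∨ (inj₂ (from T-∧ (from T-not-≡ Sv ,
    any⁺ _ (lose (∈-elements u) (from T-∧ (Xu , fromWitness e))))))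

  grow-cases : ∀ {X v} → T (grow X v) →
               T (X v) ⊎ (S v ≡ false × ∃[ u ] (T (X u) × Adj G u v))
  grow-cases g with to T-∨ g
  ... | inj₁ Xv = inj₁ Xv
  ... | inj₂ h =
    let Sv , some = to T-∧ h
        u , _ , Xu∧e = find (any⁻ _ elements some)
        Xu , e = to T-∧ Xu∧e
    in inj₂ (to T-not-≡ Sv , u , Xu , toWitness e)

  module _ (v₀ : V G) where

    Rooted : (V G → Bool) → Set
    Rooted X = T (X v₀) × (∀ {v} → T (X v) → S v ≡ false × Conn G (T ∘ X) v₀ v)

    grow-Rooted : ∀ {X} → Rooted X → Rooted (grow X)
    grow-Rooted {X} (Xv₀ , rooted) =
      grow-inflationary X Xv₀ , λ g → case grow-cases g of λ where
        (inj₁ Xv) → let Sv , c = rooted Xv in Sv , Conn-map (grow-inflationary X) c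
        (inj₂ (Sv , u , Xu , e)) →
          Sv , extend (Conn-map (grow-inflationary X) (proj₂ (rooted Xu))) e g

    singleton-Rooted : S v₀ ≡ false → Rooted (λ v → isYes (v ≟ᴳ v₀))
    singleton-Rooted Sv₀ = fromWitness refl , λ p → case toWitness p of λ where
      refl → Sv₀ , start p

    component : S v₀ ≡ false → ∃[ C ] (IsComponent G S C × C v₀ ≡ true)
    component Sv₀ = C , (nonempty , avoids , connected , maximal) , proj₂ nonempty
      where
      seed = λ v → isYes (v ≟ᴳ v₀)
      N,closed = iterate-closes elements ∈-elements grow grow-inflationary seed
      C = iterate grow seed (proj₁ N,closed)

      rooted : Rooted C
      rooted = iterate-preserves Rooted grow-Rooted (proj₁ N,closed) (singleton-Rooted Sv₀)

      nonempty : ∃[ v ] C v ≡ true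
      nonempty = v₀ , to T-≡ (proj₁ rooted)

      avoids : ∀ v → C v ≡ true → S v ≡ false
      avoids v Cv = proj₁ (proj₂ rooted (from T-≡ Cv))

      path : ∀ {v} → C v ≡ true → Conn G (λ x → C x ≡ true) v₀ v
      path Cv = Conn-map (to T-≡) (proj₂ (proj₂ rooted (from T-≡ Cv)))

      connected : ∀ u v → C u ≡ true → C v ≡ true → Conn G (λ x → C x ≡ true) u v
      connected u v Cu Cv = Conn-++ (Conn-reverse adj-sym (path Cu)) (path Cv)

      maximal : ∀ u v → C u ≡ true → Adj G u v → S v ≡ false → C v ≡ true
      maximal u v Cu e Sv = to T-≡ (proj₂ N,closed (grow-adjacent (from T-≡ Cu) e Sv))

∣p∪q∣≤∣p∣+∣q∣ : ∀ {n} (p q : Subset n) → ∣ p ∪ q ∣ ≤ ∣ p ∣ + ∣ q ∣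
∣p∪q∣≤∣p∣+∣q∣ [] [] = z≤n
∣p∪q∣≤∣p∣+∣q∣ (inside  ∷ p) (x ∷ q) =
  s≤s (≤-trans (∣p∪q∣≤∣p∣+∣q∣ p q) (+-monoʳ-≤ ∣ p ∣ (∣p∣≤∣x∷p∣ x q)))
∣p∪q∣≤∣p∣+∣q∣ (outside ∷ p) (inside  ∷ q) =
  ≤-trans (s≤s (∣p∪q∣≤∣p∣+∣q∣ p q)) (≤-reflexive (sym (+-suc ∣ p ∣ ∣ q ∣)))
∣p∪q∣≤∣p∣+∣q∣ (outside ∷ p) (outside ∷ q) = ∣p∪q∣≤∣p∣+∣q∣ p q

∣⋃⁅xs⁆∣≤length : ∀ {n} (xs : List (Fin n)) → ∣ ⋃ (map ⁅_⁆ xs) ∣ ≤ length xs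
∣⋃⁅xs⁆∣≤length {n} [] = ≤-reflexive (∣⊥∣≡0 n)
∣⋃⁅xs⁆∣≤length (x ∷ xs) = ≤-trans (∣p∪q∣≤∣p∣+∣q∣ ⁅ x ⁆ _)
  (+-mono-≤ (≤-reflexive (∣⁅x⁆∣≡1 x)) (∣⋃⁅xs⁆∣≤length xs))

∈⋃⁅xs⁆ : ∀ {n} {x : Fin n} {xs} → x ∈ xs → x ∈ₛ ⋃ (map ⁅_⁆ xs)
∈⋃⁅xs⁆ (here refl) = x∈p∪q⁺ (inj₁ (x∈⁅x⁆ _))
∈⋃⁅xs⁆ (there x∈xs) = x∈p∪q⁺ (inj₂ (∈⋃⁅xs⁆ x∈xs))

∈-tabulate : ∀ {n} (f : Fin n → Bool) {i} → f i ≡ true → i ∈ₛ tabulate f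
∈-tabulate f {i} fi = lookup⇒[]= i (tabulate f) (trans (lookup∘tabulate f i) fi)

∣p∣>0⇒Nonempty : ∀ {n} {p : Subset n} → 0 < ∣ p ∣ → Nonempty p
∣p∣>0⇒Nonempty {n} {p} 0<∣p∣ with nonempty? p
... | yes nonempty = nonempty
... | no empty with () ← subst (0 <_) (trans (cong ∣_∣ (Empty-unique empty)) (∣⊥∣≡0 n)) 0<∣p∣

fromℕ : ℕ → ℚ
fromℕ zero = 0ℚ
fromℕ (suc n) = 1ℚ +ᵣ fromℕ n

fromℕ-+ : ∀ m n → fromℕ (m + n) ≡ fromℕ m +ᵣ fromℕ n
fromℕ-+ zero n = sym (ℚ.+-identityˡ (fromℕ n))
fromℕ-+ (suc m) n = trans (cong (1ℚ +ᵣ_) (fromℕ-+ m n)) (sym (ℚ.+-assoc 1ℚ (fromℕ m) (fromℕ n)))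

0≤fromℕ : ∀ n → 0ℚ ≤ᵣ fromℕ n
0≤fromℕ zero = ℚ.≤-refl
0≤fromℕ (suc n) = ℚ.+-mono-≤ (ℚ.<⇒≤ (ℚ.positive⁻¹ 1ℚ)) (0≤fromℕ n)

fromℕ-mono-< : ∀ {m n} → m < n → fromℕ m <ᵣ fromℕ n
fromℕ-mono-< {zero} {suc n} _ = ℚ.<-≤-trans (ℚ.positive⁻¹ 1ℚ)
  (subst (_≤ᵣ 1ℚ +ᵣ fromℕ n) (ℚ.+-identityʳ 1ℚ) (ℚ.+-monoʳ-≤ 1ℚ (0≤fromℕ n)))
fromℕ-mono-< {suc m} {suc n} (s≤s m<n) = ℚ.+-monoʳ-< 1ℚ (fromℕ-mono-< m<n)

more-than-half : ∀ {h c} → h < c → ¬ (fromℕ c ≤ᵣ ½ *ᵣ fromℕ (h + h))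
more-than-half {h} h<c c≤half =
  ℚ.<-irrefl refl (ℚ.<-≤-trans (fromℕ-mono-< h<c) (subst (_ ≤ᵣ_) half≡h c≤half))
  where
  open ≡-Reasoning
  x = fromℕ h
  half≡h : ½ *ᵣ fromℕ (h + h) ≡ x
  half≡h = begin
    ½ *ᵣ fromℕ (h + h)  ≡⟨ cong (½ *ᵣ_) (fromℕ-+ h h) ⟩
    ½ *ᵣ (x +ᵣ x)       ≡⟨ ℚ.*-distribˡ-+ ½ x x ⟩
    ½ *ᵣ x +ᵣ ½ *ᵣ x    ≡⟨ ℚ.*-distribʳ-+ x ½ ½ ⟨
    (½ +ᵣ ½) *ᵣ x       ≡⟨ ℚ.*-identityˡ x ⟩
    x                   ∎

∑-zero : ∀ n {f : Fin n → ℚ} → (∀ i → f i ≡ 0ℚ) → ∑ n f ≡ 0ℚ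
∑-zero zero f≡0 = refl
∑-zero (suc n) f≡0 = cong₂ _+ᵣ_ (f≡0 zero) (∑-zero n (λ i → f≡0 (suc i)))

∑-one : ∀ n → ∑ n (λ _ → 1ℚ) ≡ fromℕ n
∑-one zero = refl
∑-one (suc n) = cong (1ℚ +ᵣ_) (∑-one n)

∑-indicator : ∀ n (f : Fin n → Bool) →
              ∑ n (λ i → if f i then 1ℚ else 0ℚ) ≡ fromℕ ∣ tabulate f ∣
∑-indicator zero f = refl
∑-indicator (suc n) f with f zero
... | true = cong (1ℚ +ᵣ_) (∑-indicator n (λ i → f (suc i)))
... | false = trans (ℚ.+-identityˡ _) (∑-indicator n (λ i → f (suc i)))

module _ {m : ℕ} where

  _≟ᵥ_ : DecidableEquality (KV m)
  orig i ≟ᵥ orig j = map′ (cong orig) (λ { refl → refl }) (i ≟ j)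
  orig _ ≟ᵥ sub _ _ = no λ ()
  sub _ _ ≟ᵥ orig _ = no λ ()
  sub i d ≟ᵥ sub j e =
    map′ (λ (p , q) → cong₂ sub p q) (λ { refl → refl , refl }) (i ≟ j ×-dec d ≟ e)

  KAdj? : Decidable (KAdj m)
  KAdj? (orig _) (orig _) = no λ ()
  KAdj? (orig i) (sub j d) = map′ (λ { refl → o-s i d }) (λ { (o-s _ _) → refl }) (i ≟ j)
  KAdj? (sub i d) (orig j) = map′ (λ { refl → s-o i d }) (λ { (s-o _ _) → refl }) (i ≟ j)
  KAdj? (sub i d) (sub j e) = map′ (λ (p , q) → s-s i d j e p q)
    (λ { (s-s _ _ _ _ p q) → p , q }) (punchIn i d ≟ j ×-dec punchIn j e ≟ i)

  KAdj-sym : Symmetric (KAdj m)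
  KAdj-sym (o-s i d) = s-o i d
  KAdj-sym (s-o i d) = o-s i d
  KAdj-sym (s-s i d j e p q) = s-s j e i d q p

  vertices : List (KV m)
  vertices = map orig (allFin (suc m)) ++ cartesianProductWith sub (allFin (suc m)) (allFin m)

  ∈-vertices : ∀ v → v ∈ vertices
  ∈-vertices (orig i) = ∈-++⁺ˡ (∈-map⁺ orig (∈-allFin i))
  ∈-vertices (sub i d) =
    ∈-++⁺ʳ (map orig (allFin (suc m))) (∈-cartesianProductWith⁺ sub (∈-allFin i) (∈-allFin d))

  branchWeight : KV m → ℚ
  branchWeight (orig _) = 1ℚ
  branchWeight (sub _ _) = 0ℚ

  0≤branchWeight : ∀ v → 0ℚ ≤ᵣ branchWeight v
  0≤branchWeight (orig _) = ℚ.<⇒≤ (ℚ.positive⁻¹ 1ℚ)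
  0≤branchWeight (sub _ _) = ℚ.≤-refl

  weight-branchWeight : ∀ C → weight (K⁽²⁾ m) branchWeight C ≡ fromℕ ∣ tabulate (C ∘ orig) ∣
  weight-branchWeight C = trans (cong₂ _+ᵣ_ (∑-indicator (suc m) (C ∘ orig))
    (∑-zero (suc m) λ i → ∑-zero m λ d → if-eta (C (sub i d)))) (ℚ.+-identityʳ _)

  sumV-branchWeight : sumV (K⁽²⁾ m) branchWeight ≡ fromℕ (suc m)
  sumV-branchWeight = trans (cong₂ _+ᵣ_ (∑-one (suc m))
    (∑-zero (suc m) λ _ → ∑-zero m λ _ → refl)) (ℚ.+-identityʳ _)

  owner : KV m → Fin (suc m)
  owner (orig i) = i
  owner (sub i _) = i

  owner-near-orig : ∀ {s i} → Dist≤ (K⁽²⁾ m) 1 s (orig i) → owner s ≡ i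
  owner-near-orig here = refl
  owner-near-orig (step (s-o _ _) here) = refl

  owner-near-sub : ∀ {s i d} → Dist≤ (K⁽²⁾ m) 1 s (sub i d) →
                   owner s ≡ i ⊎ owner s ≡ punchIn i d
  owner-near-sub here = inj₁ refl
  owner-near-sub (step (o-s _ _) here) = inj₁ refl
  owner-near-sub (step (s-s _ _ _ _ _ q) here) = inj₂ (sym q)

  owned : List (KV m) → Subset (suc m)
  owned Ŝ = ⋃ (map ⁅_⁆ (map owner Ŝ))

  ∣owned∣≤length : ∀ Ŝ → ∣ owned Ŝ ∣ ≤ length Ŝ
  ∣owned∣≤length Ŝ = subst (∣ owned Ŝ ∣ ≤_) (length-map owner Ŝ) (∣⋃⁅xs⁆∣≤length (map owner Ŝ))

  module _ {Ŝ : List (KV m)} {S : KV m → Bool}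
           (covered : ∀ v → S v ≡ true → ∃[ s ] (s ∈ Ŝ × Dist≤ (K⁽²⁾ m) 1 s v)) where

    owned-near : ∀ {v} → S v ≡ true → ∃[ s ] (owner s ∈ₛ owned Ŝ × Dist≤ (K⁽²⁾ m) 1 s v)
    owned-near Sv = let s , s∈Ŝ , near = covered _ Sv in s , ∈⋃⁅xs⁆ (∈-map⁺ owner s∈Ŝ) , near

    orig-∉S : ∀ {i} → i ∉ owned Ŝ → S (orig i) ≡ false
    orig-∉S i∉ = ¬-not λ Sv → let s , owned-s , near = owned-near Sv in
      i∉ (subst (_∈ₛ owned Ŝ) (owner-near-orig near) owned-s)

    sub-∉S : ∀ {i d} → i ∉ owned Ŝ → punchIn i d ∉ owned Ŝ → S (sub i d) ≡ false
    sub-∉S i∉ j∉ = ¬-not λ Sv → let s , owned-s , near = owned-near Sv in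
      case owner-near-sub near of λ where
        (inj₁ p) → i∉ (subst (_∈ₛ owned Ŝ) p owned-s)
        (inj₂ p) → j∉ (subst (_∈ₛ owned Ŝ) p owned-s)

    unowned-linked : ∀ {i j} → i ∉ owned Ŝ → j ∉ owned Ŝ →
                     Conn (K⁽²⁾ m) (λ x → S x ≡ false) (orig i) (orig j)
    unowned-linked {i} {j} i∉ j∉ with i ≟ j
    ... | yes refl = start (orig-∉S i∉)
    ... | no i≢j =
      extend (extend (extend (start (orig-∉S i∉))
        (o-s i d) (sub-∉S i∉ (subst (_∉ owned Ŝ) (sym ij) j∉)))
        (s-s i d j e ij ji) (sub-∉S j∉ (subst (_∉ owned Ŝ) (sym ji) i∉)))
        (s-o j e) (orig-∉S j∉)
      where
      d = punchOut i≢j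
      e = punchOut (i≢j ∘ sym)
      ij = punchIn-punchOut i≢j
      ji = punchIn-punchOut (i≢j ∘ sym)

    unowned⊆component : ∀ {C i} → IsComponent (K⁽²⁾ m) S C → C (orig i) ≡ true →
                        i ∉ owned Ŝ → ∁ (owned Ŝ) ⊆ tabulate (C ∘ orig)
    unowned⊆component {C} C-component Ci i∉ j∈ = ∈-tabulate (C ∘ orig)
      (IsComponent-closed C-component Ci (unowned-linked i∉ (x∈∁p⇒x∉p j∈)))

unowned-many : ∀ k (Ŝ : List (KV (suc (2 * k)))) → length Ŝ ≤ k → suc (suc k) ≤ ∣ ∁ (owned Ŝ) ∣
unowned-many k Ŝ |Ŝ|≤k = begin
  suc (suc k)                     ≡⟨ m+n∸m≡n k (suc (suc k)) ⟨
  k + suc (suc k) ∸ k             ≡⟨ cong (_∸ k) (2+2k≡k+[2+k] k) ⟨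
  suc (suc (2 * k)) ∸ k           ≤⟨ ∸-monoʳ-≤ _ (≤-trans (∣owned∣≤length Ŝ) |Ŝ|≤k) ⟩
  suc (suc (2 * k)) ∸ ∣ owned Ŝ ∣ ≡⟨ ∣∁p∣≡n∸∣p∣ (owned Ŝ) ⟨
  ∣ ∁ (owned Ŝ) ∣                 ∎
  where
  open ≤-Reasoning
  2+2k≡k+[2+k] : ∀ k → suc (suc (2 * k)) ≡ k + suc (suc k)
  2+2k≡k+[2+k] = solve-∀

heavy-component : ∀ k {S} → Centred (K⁽²⁾ (suc (2 * k))) k 1 S →
                  ∃[ C ] (IsComponent (K⁽²⁾ (suc (2 * k))) S C × suc k < ∣ tabulate (C ∘ orig) ∣)
heavy-component k {S} (Ŝ , |Ŝ|≤k , covered) =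
  let i₀ , i₀∈ = ∣p∣>0⇒Nonempty (≤-trans (s≤s z≤n) many)
      i₀∉ = x∈∁p⇒x∉p i₀∈
      C , C-component , Ci₀ = component (K⁽²⁾ _) vertices ∈-vertices _≟ᵥ_ KAdj? KAdj-sym S
                                        (orig i₀) (orig-∉S covered i₀∉)
  in C , C-component ,
     ≤-trans many (p⊆q⇒∣p∣≤∣q∣ (unowned⊆component covered C-component Ci₀ i₀∉))
  where
  many = unowned-many k Ŝ |Ŝ|≤k

lemma8 : ∀ (k : ℕ) → ¬ AdmitsBalancedSeps (K⁽²⁾ (suc (2 * k))) k 1
lemma8 k admits =
  let S , centred , balanced = admits branchWeight 0≤branchWeight
      C , C-component , heavy = heavy-component k centred
  in more-than-half heavy (subst₂ _≤ᵣ_ (weight-branchWeight C) (cong (½ *ᵣ_) total)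
                                        (balanced C C-component))
  where
  total : sumV (K⁽²⁾ (suc (2 * k))) branchWeight ≡ fromℕ (suc k + suc k)
  total = trans (sumV-branchWeight {suc (2 * k)}) (cong fromℕ (2+2k≡[1+k]+[1+k] k))
    where
    2+2k≡[1+k]+[1+k] : ∀ k → suc (suc (2 * k)) ≡ suc k + suc k
    2+2k≡[1+k]+[1+k] = solve-∀
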